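{- Let $G=(V,E)$ be an undirected graph with positive edge weights and $T\subseteq V$ a terminal set. The family of all supreme sets is laminar, i.e., no two supreme sets cross.
   Context: For $X\subseteq V$, $d(X)$ is the total weight of edges with exactly one endpoint in $X$. A Steiner cut is a set $X\subseteq V$ with $X\cap T\neq\emptyset$ and $T\not\subseteq X$. A Steiner cut $X$ is extreme if every Steiner cut $Y\subsetneq X$ satisfies $d(Y)>d(X)$. For $R\subseteq T$, if some extreme set $X$ has $X\cap T=R$, the supreme set of $R$ is $\mu(R)=\bigcup\{X : X \text{ extreme},\ X\cap T=R\}$; otherwise $\mu(R)$ is undefined. The supreme sets are the sets $\mu(R)$ that are defined. Two sets $X,Y$ cross if $X\cap Y$, $X\setminus Y$, $Y\setminus X$ are all nonempty.
   Formalization: The edge weights are positive rationals. -}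

module Defs where

open import Data.Nat using (ℕ)
open import Data.Fin using (Fin)
open import Data.Fin.Subset using (Subset; _∈_; _⊆_; _⊂_; _∩_; _─_; Nonempty)
open import Data.Bool using (Bool; true; false; _xor_)
open import Data.Vec using (lookup)
open import Data.List using (List; foldr)
open import Data.List.Relation.Unary.All using (All)
open import Data.Product using (_×_; _,_; Σ; ∃)
open import Data.Rational using (ℚ; 0ℚ; _+_; _<_)
open import Relation.Nullary using (¬_)
open import Relation.Binary.PropositionalEquality using (_≡_)
open import Function.Bundles using (_⇔_)

-- An undirected weighted (multi)graph on the vertex set V = Fin n:
-- a list of edges {u , v} with rational weight w.
Edge : ℕ → Set
Edge n = Fin n × Fin n × ℚ

weight : ∀ {n} → Edge n → ℚ
weight (_ , _ , w) = w

PositiveWeights : ∀ {n} → List (Edge n) → Set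
PositiveWeights E = All (λ e → 0ℚ < weight e) E

contrib : ∀ {n} → Subset n → Edge n → ℚ
contrib X (u , v , w) with lookup X u xor lookup X v
... | true  = w
... | false = 0ℚ

cutWeight : ∀ {n} → List (Edge n) → Subset n → ℚ
cutWeight E X = foldr (λ e acc → contrib X e + acc) 0ℚ E

SteinerCut : ∀ {n} → Subset n → Subset n → Set
SteinerCut T X = Nonempty (X ∩ T) × ¬ (T ⊆ X)

Extreme : ∀ {n} → List (Edge n) → Subset n → Subset n → Set
Extreme E T X = SteinerCut T X ×
  (∀ Y → SteinerCut T Y → Y ⊂ X → cutWeight E X < cutWeight E Y)

IsSupremeOf : ∀ {n} → List (Edge n) → Subset n → Subset n → Subset n → Set
IsSupremeOf E T R S =
  (∃ λ X → Extreme E T X × (X ∩ T ≡ R)) ×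
  (∀ v → (v ∈ S) ⇔ (∃ λ X → Extreme E T X × (X ∩ T ≡ R) × v ∈ X))

Supreme : ∀ {n} → List (Edge n) → Subset n → Subset n → Set
Supreme E T S = ∃ λ R → R ⊆ T × IsSupremeOf E T R S

Cross : ∀ {n} → Subset n → Subset n → Set
Cross X Y = Nonempty (X ∩ Y) × Nonempty (X ─ Y) × Nonempty (Y ─ X)

{-# OPTIONS --safe #-}
module Submission where

-- The cut function d is symmetric and submodular, hence posimodular:
-- d (X ∖ Y) + d (Y ∖ X) ≤ d X + d Y. By submodularity the union of extreme
-- sets X, Y with X ∩ T ⊆ Y ∩ T is again extreme, with trace Y ∩ T; hence
-- R₁ ⊆ R₂ implies μ(R₁) ⊆ μ(R₂), and supreme sets with comparable traces are
-- nested. If the traces are incomparable, extreme sets X and Y through a common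
-- vertex would make X ∖ Y and Y ∖ X Steiner cuts strictly inside X and Y, so
-- d (X ∖ Y) + d (Y ∖ X) > d X + d Y, contradicting posimodularity.

open import Defs
open import Algebra.Bundles using (CommutativeMonoid)
open import Data.Bool using (Bool; true; false; T; not; _∧_; _∨_; _xor_)
open import Data.Bool.Properties using (∧-zeroʳ; ∧-identityʳ; not-involutive)
open import Data.Fin.Properties using (any?)
open import Data.Fin.Subset
  using (Subset; _∈_; _∉_; _⊆_; _⊂_; ∁; _∩_; _∪_; _─_; Nonempty)
open import Data.Fin.Subset.Properties
  using ( _∈?_; _⊆?_; ⊆-refl; ⊆-trans; ⊆-antisym; x∈p∩q⁺; x∈p∩q⁻; p∩q⊆p; p∩q⊆q
        ; x∈p∪q⁻; p⊆p∪q; q⊆p∪q; ∩-assoc; ∩-comm; ∪-comm; ∩-distribʳ-∪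
        ; x∈∁p⇒x∉p; x∈p∧x∉q⇒x∈p─q; p─q⊆p; p∩q≢∅⇒p─q⊂p)
open import Data.List using (List; []; _∷_)
open import Data.List.Relation.Unary.All as All using (All; []; _∷_)
open import Data.Nat using (ℕ)
open import Data.Product using (_×_; _,_; ∃)
open import Data.Rational using (ℚ; 0ℚ; _+_; _≤_; _<_)
open import Data.Rational.Properties
  using ( ≤-refl; ≤-reflexive; ≤-trans; <⇒≤; ≰⇒>; <-irrefl; <-≤-trans; _≤?_
        ; +-comm; +-mono-≤; +-mono-<; +-mono-<-≤; +-0-commutativeMonoid; module ≤-Reasoning)
open import Data.Sum using ([_,_]′)
open import Data.Vec using ([]; _∷_; lookup)
open import Data.Vec.Properties using (lookup-map; lookup-zipWith)
open import Function using (_∘_)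
open import Function.Bundles using (Equivalence)
open import Relation.Nullary using (¬_; yes; no; contradiction)
open import Relation.Nullary.Decidable using (¬?; _×-dec_; decidable-stable)
open import Relation.Binary.PropositionalEquality
  using (_≡_; refl; sym; trans; cong; cong₂; subst; module ≡-Reasoning)
open import Algebra.Properties.CommutativeSemigroup
  (CommutativeMonoid.commutativeSemigroup +-0-commutativeMonoid) using (interchange)

<-from-+-≤ : ∀ {a b c e : ℚ} → a + b ≤ c + e → e < a → b < c
<-from-+-≤ {a} {b} {c} {e} a+b≤c+e e<a with c ≤? b
... | no c≰b = ≰⇒> c≰b
... | yes c≤b = contradiction
  (<-≤-trans (+-mono-<-≤ e<a c≤b) (≤-trans a+b≤c+e (≤-reflexive (+-comm c e))))
  (<-irrefl refl)

p∩∁q≡p─q : ∀ {n} (p q : Subset n) → p ∩ ∁ q ≡ p ─ q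
p∩∁q≡p─q []      []          = refl
p∩∁q≡p─q (x ∷ p) (true  ∷ q) = cong₂ _∷_ (∧-zeroʳ x) (p∩∁q≡p─q p q)
p∩∁q≡p─q (x ∷ p) (false ∷ q) = cong₂ _∷_ (∧-identityʳ x) (p∩∁q≡p─q p q)

∁[q─p]≡p∪∁q : ∀ {n} (p q : Subset n) → ∁ (q ─ p) ≡ p ∪ ∁ q
∁[q─p]≡p∪∁q []          []      = refl
∁[q─p]≡p∪∁q (true  ∷ p) (y ∷ q) = cong (true ∷_) (∁[q─p]≡p∪∁q p q)
∁[q─p]≡p∪∁q (false ∷ p) (y ∷ q) = cong (not y ∷_) (∁[q─p]≡p∪∁q p q)

module _ {n : ℕ} where

  ⊈⇒∃∈∉ : {p q : Subset n} → ¬ (p ⊆ q) → ∃ λ x → x ∈ p × x ∉ q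
  ⊈⇒∃∈∉ {p} {q} p⊈q with any? (λ x → x ∈? p ×-dec ¬? (x ∈? q))
  ... | yes witness = witness
  ... | no none = contradiction
    (λ {x} x∈p → decidable-stable (x ∈? q) (λ x∉q → none (x , x∈p , x∉q)))
    p⊈q

  ∪-lub : {p q r : Subset n} → p ⊆ r → q ⊆ r → p ∪ q ⊆ r
  ∪-lub {p} {q} p⊆r q⊆r x∈p∪q = [ p⊆r , q⊆r ]′ (x∈p∪q⁻ p q x∈p∪q)

  p⊆q⇒p∪q≡q : {p q : Subset n} → p ⊆ q → p ∪ q ≡ q
  p⊆q⇒p∪q≡q {p} {q} p⊆q = ⊆-antisym (∪-lub p⊆q ⊆-refl) (q⊆p∪q p q)

  ∪-sandwich : {p q r : Subset n} → q ⊆ r → r ⊆ p ∪ q → r ∪ p ≡ p ∪ q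
  ∪-sandwich {p} {q} {r} q⊆r r⊆p∪q =
    ⊆-antisym (∪-lub r⊆p∪q (p⊆p∪q q)) (∪-lub (q⊆p∪q r p) (⊆-trans q⊆r (p⊆p∪q p)))

  ─≢∅⇒⊈ : {p q : Subset n} → Nonempty (p ─ q) → ¬ (p ⊆ q)
  ─≢∅⇒⊈ {p} {q} (x , x∈p─q) p⊆q = x∈∁p⇒x∉p x∈∁q (p⊆q (p─q⊆p p q x∈p─q))
    where
    x∈∁q : x ∈ ∁ q
    x∈∁q = p∩q⊆q p (∁ q) (subst (x ∈_) (sym (p∩∁q≡p─q p q)) x∈p─q)

module _ {n : ℕ} {T : Subset n} where

  SteinerCut-⊆ : {X Y : Subset n} → SteinerCut T X → Y ⊆ X → Nonempty (Y ∩ T) → SteinerCut T Y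
  SteinerCut-⊆ (_ , T⊈X) Y⊆X Y∩T≢∅ = Y∩T≢∅ , λ T⊆Y → T⊈X (⊆-trans T⊆Y Y⊆X)

  SteinerCut-trace : {X Y : Subset n} → X ∩ T ≡ Y ∩ T → SteinerCut T X → SteinerCut T Y
  SteinerCut-trace {X} {Y} X∩T≡Y∩T (X∩T≢∅ , T⊈X) =
    subst Nonempty X∩T≡Y∩T X∩T≢∅ ,
    λ T⊆Y → T⊈X (λ t∈T → p∩q⊆p X T (subst (_ ∈_) (sym X∩T≡Y∩T) (x∈p∩q⁺ (T⊆Y t∈T , t∈T))))

  SteinerCut-─ : {X Y : Subset n} → SteinerCut T X → ¬ (X ∩ T ⊆ Y ∩ T) → SteinerCut T (X ─ Y)
  SteinerCut-─ {X} {Y} cutX X∩T⊈Y∩T with ⊈⇒∃∈∉ X∩T⊈Y∩T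
  ... | t , t∈X∩T , t∉Y∩T with x∈p∩q⁻ X T t∈X∩T
  ...   | t∈X , t∈T = SteinerCut-⊆ cutX (p─q⊆p X Y)
          (t , x∈p∩q⁺ (x∈p∧x∉q⇒x∈p─q t∈X (λ t∈Y → t∉Y∩T (x∈p∩q⁺ (t∈Y , t∈T))) , t∈T))

  trace-∪ : {X Y : Subset n} → X ∩ T ⊆ Y ∩ T → (X ∪ Y) ∩ T ≡ Y ∩ T
  trace-∪ {X} {Y} X∩T⊆Y∩T = trans (∩-distribʳ-∪ T X Y) (p⊆q⇒p∪q≡q X∩T⊆Y∩T)

weightIf : Bool → ℚ → ℚ
weightIf true  w = w
weightIf false _ = 0ℚ

contrib≡weightIf : ∀ {n} (X : Subset n) u v w →
  contrib X (u , v , w) ≡ weightIf (lookup X u xor lookup X v) w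
contrib≡weightIf X u v w with lookup X u xor lookup X v
... | true  = refl
... | false = refl

_≤ᵇ_ : Bool → Bool → Bool
r ≤ᵇ p = not r ∨ p

weightIf-mono : ∀ {w} → 0ℚ ≤ w → ∀ r p → T (r ≤ᵇ p) → weightIf r w ≤ weightIf p w
weightIf-mono _   true  true  _ = ≤-refl
weightIf-mono 0≤w false true  _ = 0≤w
weightIf-mono _   false false _ = ≤-refl

weightIf-∧-∨ : ∀ r s w → weightIf r w + weightIf s w ≡ weightIf (r ∧ s) w + weightIf (r ∨ s) w
weightIf-∧-∨ true  s w = +-comm w (weightIf s w)
weightIf-∧-∨ false s w = refl

-- (r , s) is componentwise below (p , q) or (q , p) exactly when its minimum and maximum are.
record Dominated (r s p q : Bool) : Set where
  constructor _,_
  field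
    min≤ : T ((r ∧ s) ≤ᵇ (p ∧ q))
    max≤ : T ((r ∨ s) ≤ᵇ (p ∨ q))

weightIf-dominated : ∀ {w} → 0ℚ ≤ w → ∀ {r s p q} → Dominated r s p q →
  weightIf r w + weightIf s w ≤ weightIf p w + weightIf q w
weightIf-dominated {w} 0≤w {r} {s} {p} {q} (min≤ , max≤) = begin
  weightIf r w + weightIf s w              ≡⟨ weightIf-∧-∨ r s w ⟩
  weightIf (r ∧ s) w + weightIf (r ∨ s) w
    ≤⟨ +-mono-≤ (weightIf-mono 0≤w (r ∧ s) (p ∧ q) min≤) (weightIf-mono 0≤w (r ∨ s) (p ∨ q) max≤) ⟩
  weightIf (p ∧ q) w + weightIf (p ∨ q) w  ≡⟨ weightIf-∧-∨ p q w ⟨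
  weightIf p w + weightIf q w              ∎
  where open ≤-Reasoning

∧-∨-dominated : ∀ xu xv yu yv →
  Dominated ((xu ∧ yu) xor (xv ∧ yv)) ((xu ∨ yu) xor (xv ∨ yv)) (xu xor xv) (yu xor yv)
∧-∨-dominated true  true  true  true  = _
∧-∨-dominated true  true  true  false = _
∧-∨-dominated true  true  false true  = _
∧-∨-dominated true  true  false false = _
∧-∨-dominated true  false true  true  = _
∧-∨-dominated true  false true  false = _
∧-∨-dominated true  false false true  = _
∧-∨-dominated true  false false false = _
∧-∨-dominated false true  true  true  = _
∧-∨-dominated false true  true  false = _
∧-∨-dominated false true  false true  = _
∧-∨-dominated false true  false false = _
∧-∨-dominated false false true  true  = _
∧-∨-dominated false false true  false = _
∧-∨-dominated false false false true  = _
∧-∨-dominated false false false false = _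

not-xor-not : ∀ a b → not a xor not b ≡ a xor b
not-xor-not true  b = refl
not-xor-not false b = not-involutive b

module _ {n : ℕ} where

  contrib-submodular : ∀ (X Y : Subset n) e → 0ℚ ≤ weight e →
    contrib (X ∩ Y) e + contrib (X ∪ Y) e ≤ contrib X e + contrib Y e
  contrib-submodular X Y (u , v , w) 0≤w
    rewrite contrib≡weightIf (X ∩ Y) u v w | contrib≡weightIf (X ∪ Y) u v w
          | contrib≡weightIf X u v w | contrib≡weightIf Y u v w
          | lookup-zipWith _∧_ u X Y | lookup-zipWith _∧_ v X Y
          | lookup-zipWith _∨_ u X Y | lookup-zipWith _∨_ v X Y
    = weightIf-dominated 0≤w (∧-∨-dominated (lookup X u) (lookup X v) (lookup Y u) (lookup Y v))

  contrib-∁ : ∀ (X : Subset n) e → contrib (∁ X) e ≡ contrib X e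
  contrib-∁ X (u , v , w) = begin
    contrib (∁ X) (u , v , w)                           ≡⟨ contrib≡weightIf (∁ X) u v w ⟩
    weightIf (lookup (∁ X) u xor lookup (∁ X) v) w      ≡⟨ cong₂ (λ a b → weightIf (a xor b) w) (lookup-map u not X) (lookup-map v not X) ⟩
    weightIf (not (lookup X u) xor not (lookup X v)) w  ≡⟨ cong (λ b → weightIf b w) (not-xor-not (lookup X u) (lookup X v)) ⟩
    weightIf (lookup X u xor lookup X v) w              ≡⟨ contrib≡weightIf X u v w ⟨
    contrib X (u , v , w)                               ∎
    where open ≡-Reasoning

  NonNegativeWeights : List (Edge n) → Set
  NonNegativeWeights E = All (λ e → 0ℚ ≤ weight e) E

  cutWeight-edgewise-≤ : ∀ {E : List (Edge n)} (X′ Y′ X Y : Subset n) →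
    (∀ e → 0ℚ ≤ weight e → contrib X′ e + contrib Y′ e ≤ contrib X e + contrib Y e) →
    NonNegativeWeights E → cutWeight E X′ + cutWeight E Y′ ≤ cutWeight E X + cutWeight E Y
  cutWeight-edgewise-≤ X′ Y′ X Y edge≤ [] = ≤-refl
  cutWeight-edgewise-≤ {e ∷ E} X′ Y′ X Y edge≤ (0≤w ∷ nonneg) = begin
    (contrib X′ e + cutWeight E X′) + (contrib Y′ e + cutWeight E Y′)
      ≡⟨ interchange (contrib X′ e) (cutWeight E X′) (contrib Y′ e) (cutWeight E Y′) ⟩
    (contrib X′ e + contrib Y′ e) + (cutWeight E X′ + cutWeight E Y′)
      ≤⟨ +-mono-≤ (edge≤ e 0≤w) (cutWeight-edgewise-≤ X′ Y′ X Y edge≤ nonneg) ⟩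
    (contrib X e + contrib Y e) + (cutWeight E X + cutWeight E Y)
      ≡⟨ interchange (contrib X e) (contrib Y e) (cutWeight E X) (cutWeight E Y) ⟩
    (contrib X e + cutWeight E X) + (contrib Y e + cutWeight E Y)
      ∎
    where open ≤-Reasoning

  cutWeight-∁ : ∀ (E : List (Edge n)) X → cutWeight E (∁ X) ≡ cutWeight E X
  cutWeight-∁ []      X = refl
  cutWeight-∁ (e ∷ E) X = cong₂ _+_ (contrib-∁ X e) (cutWeight-∁ E X)

  module _ {E : List (Edge n)} (nonneg : NonNegativeWeights E) where

    private
      d : Subset n → ℚ
      d = cutWeight E

    cutWeight-submodular : ∀ X Y → d (X ∩ Y) + d (X ∪ Y) ≤ d X + d Y
    cutWeight-submodular X Y = cutWeight-edgewise-≤ (X ∩ Y) (X ∪ Y) X Y (contrib-submodular X Y) nonneg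

    cutWeight-posimodular : ∀ X Y → d (X ─ Y) + d (Y ─ X) ≤ d X + d Y
    cutWeight-posimodular X Y = begin
      d (X ─ Y) + d (Y ─ X)          ≡⟨ cong₂ _+_ (cong d (p∩∁q≡p─q X Y)) (cutWeight-∁ E (Y ─ X)) ⟨
      d (X ∩ ∁ Y) + d (∁ (Y ─ X))    ≡⟨ cong (λ Z → d (X ∩ ∁ Y) + d Z) (∁[q─p]≡p∪∁q X Y) ⟩
      d (X ∩ ∁ Y) + d (X ∪ ∁ Y)      ≤⟨ cutWeight-submodular X (∁ Y) ⟩
      d X + d (∁ Y)                  ≡⟨ cong (d X +_) (cutWeight-∁ E Y) ⟩
      d X + d Y                      ∎
      where open ≤-Reasoning

    module _ (T : Subset n) where

      d[Z∪X]<d[Z] : ∀ {X Z} → Extreme E T X → Nonempty (Z ∩ X ∩ T) → ¬ (X ⊆ Z) → d (Z ∪ X) < d Z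
      d[Z∪X]<d[Z] {X} {Z} (cutX , minX) Z∩X∩T≢∅ X⊈Z =
        <-from-+-≤ (cutWeight-submodular Z X) (minX (Z ∩ X) cutZ∩X Z∩X⊂X)
        where
        cutZ∩X : SteinerCut T (Z ∩ X)
        cutZ∩X = SteinerCut-⊆ cutX (p∩q⊆q Z X) (subst Nonempty (sym (∩-assoc Z X T)) Z∩X∩T≢∅)
        Z∩X⊂X : Z ∩ X ⊂ X
        Z∩X⊂X with ⊈⇒∃∈∉ X⊈Z
        ... | x , x∈X , x∉Z = p∩q⊆q Z X , x , x∈X , x∉Z ∘ p∩q⊆p Z X

      d[Z∪X]≤d[Z] : ∀ {X Z} → Extreme E T X → Nonempty (Z ∩ X ∩ T) → d (Z ∪ X) ≤ d Z
      d[Z∪X]≤d[Z] {X} {Z} extX Z∩X∩T≢∅ with X ⊆? Z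
      ... | yes X⊆Z = ≤-reflexive (cong d (trans (∪-comm Z X) (p⊆q⇒p∪q≡q X⊆Z)))
      ... | no X⊈Z  = <⇒≤ (d[Z∪X]<d[Z] extX Z∩X∩T≢∅ X⊈Z)

      extreme-∪ : ∀ {X Y} → Extreme E T X → Extreme E T Y → X ∩ T ⊆ Y ∩ T → Extreme E T (X ∪ Y)
      extreme-∪ {X} {Y} extX@(((t , t∈X∩T) , _) , _) (cutY , minY) X∩T⊆Y∩T =
        SteinerCut-trace (sym (trace-∪ X∩T⊆Y∩T)) cutY , minimal
        where
        t∈Y : t ∈ Y
        t∈Y = p∩q⊆p Y T (X∩T⊆Y∩T t∈X∩T)

        minimal : ∀ Z → SteinerCut T Z → Z ⊂ X ∪ Y → d (X ∪ Y) < d Z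
        minimal Z ((s , s∈Z∩T) , _) (Z⊆X∪Y , x , x∈X∪Y , x∉Z) with Y ⊆? Z
        ... | yes Y⊆Z = subst (λ W → d W < d Z) (∪-sandwich Y⊆Z Z⊆X∪Y)
                (d[Z∪X]<d[Z] extX (t , x∈p∩q⁺ (Y⊆Z t∈Y , t∈X∩T)) (λ X⊆Z → x∉Z (∪-lub X⊆Z Y⊆Z x∈X∪Y)))
        ... | no Y⊈Z with x∈p∩q⁻ Z T s∈Z∩T
        ...   | s∈Z , s∈T = begin-strict
          d (X ∪ Y)        ≡⟨ cong d (∪-sandwich (q⊆p∪q Z Y) (∪-lub Z⊆X∪Y (q⊆p∪q X Y))) ⟨
          d ((Z ∪ Y) ∪ X)  ≤⟨ d[Z∪X]≤d[Z] extX (t , x∈p∩q⁺ (q⊆p∪q Z Y t∈Y , t∈X∩T)) ⟩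
          d (Z ∪ Y)        <⟨ d[Z∪X]<d[Z] (cutY , minY) (s , x∈p∩q⁺ (s∈Z , s∈Y∩T)) Y⊈Z ⟩
          d Z              ∎
          where
          open ≤-Reasoning
          s∈Y∩T : s ∈ Y ∩ T
          s∈Y∩T = subst (s ∈_) (trace-∪ X∩T⊆Y∩T) (x∈p∩q⁺ (Z⊆X∪Y s∈Z , s∈T))

      extremes-disjoint : ∀ {X Y} → Extreme E T X → Extreme E T Y →
        ¬ (X ∩ T ⊆ Y ∩ T) → ¬ (Y ∩ T ⊆ X ∩ T) → ¬ Nonempty (X ∩ Y)
      extremes-disjoint {X} {Y} (cutX , minX) (cutY , minY) X∩T⊈Y∩T Y∩T⊈X∩T X∩Y≢∅ =
        <-irrefl refl (<-≤-trans (+-mono-< dX<d[X─Y] dY<d[Y─X]) (cutWeight-posimodular X Y))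
        where
        dX<d[X─Y] : d X < d (X ─ Y)
        dX<d[X─Y] = minX (X ─ Y) (SteinerCut-─ cutX X∩T⊈Y∩T) (p∩q≢∅⇒p─q⊂p X Y X∩Y≢∅)
        dY<d[Y─X] : d Y < d (Y ─ X)
        dY<d[Y─X] = minY (Y ─ X) (SteinerCut-─ cutY Y∩T⊈X∩T)
                      (p∩q≢∅⇒p─q⊂p Y X (subst Nonempty (∩-comm X Y) X∩Y≢∅))

      μ-mono : ∀ {R₁ R₂ S₁ S₂} → IsSupremeOf E T R₁ S₁ → IsSupremeOf E T R₂ S₂ → R₁ ⊆ R₂ → S₁ ⊆ S₂
      μ-mono (_ , S₁-members) ((Y , extY , refl) , S₂-members) R₁⊆R₂ {v} v∈S₁
        with Equivalence.to (S₁-members v) v∈S₁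
      ... | X , extX , refl , v∈X = Equivalence.from (S₂-members v)
        (X ∪ Y , extreme-∪ extX extY R₁⊆R₂ , trace-∪ R₁⊆R₂ , p⊆p∪q Y v∈X)

      μ-disjoint : ∀ {R₁ R₂ S₁ S₂} → IsSupremeOf E T R₁ S₁ → IsSupremeOf E T R₂ S₂ →
        ¬ (R₁ ⊆ R₂) → ¬ (R₂ ⊆ R₁) → ¬ Nonempty (S₁ ∩ S₂)
      μ-disjoint {S₁ = S₁} {S₂} (_ , S₁-members) (_ , S₂-members) R₁⊈R₂ R₂⊈R₁ (v , v∈S₁∩S₂)
        with Equivalence.to (S₁-members v) (p∩q⊆p S₁ S₂ v∈S₁∩S₂)
           | Equivalence.to (S₂-members v) (p∩q⊆q S₁ S₂ v∈S₁∩S₂)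
      ... | X , extX , refl , v∈X | Y , extY , refl , v∈Y =
        extremes-disjoint extX extY R₁⊈R₂ R₂⊈R₁ (v , x∈p∩q⁺ (v∈X , v∈Y))

      supremes-non-crossing : ∀ {R₁ R₂ S₁ S₂} → IsSupremeOf E T R₁ S₁ → IsSupremeOf E T R₂ S₂ →
        ¬ Cross S₁ S₂
      supremes-non-crossing {R₁} {R₂} μR₁ μR₂ (S₁∩S₂≢∅ , S₁─S₂≢∅ , S₂─S₁≢∅) with R₁ ⊆? R₂ | R₂ ⊆? R₁
      ... | yes R₁⊆R₂ | _         = ─≢∅⇒⊈ S₁─S₂≢∅ (μ-mono μR₁ μR₂ R₁⊆R₂)
      ... | no _      | yes R₂⊆R₁ = ─≢∅⇒⊈ S₂─S₁≢∅ (μ-mono μR₂ μR₁ R₂⊆R₁)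
      ... | no R₁⊈R₂  | no R₂⊈R₁  = μ-disjoint μR₁ μR₂ R₁⊈R₂ R₂⊈R₁ S₁∩S₂≢∅

mainTheorem6 : (n : ℕ) (E : List (Edge n)) → PositiveWeights E →
    (T : Subset n) → (S₁ S₂ : Subset n) →
    Supreme E T S₁ → Supreme E T S₂ → ¬ Cross S₁ S₂
mainTheorem6 n E pos T S₁ S₂ (_ , _ , μR₁) (_ , _ , μR₂) =
  supremes-non-crossing (All.map <⇒≤ pos) T μR₁ μR₂
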